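{- Let $E_1,E_2$ be propositional variables and $\delta$ a new atomic formula symbol. Write $\veebar$ for exclusive disjunction. Then $\mathsf{QLP}^-(\delta\leftrightarrow[E_1\wedge\neg(\exists x)x:(\delta\rightarrow E_1)]\veebar[E_2\wedge\neg(\exists x)x:(\delta\wedge\neg E_1\rightarrow E_2)])_{\emptyset}\nvdash\neg\delta$, where this logic is $\mathsf{QLP}^-$ without Axiom Necessitation, over the language extended by $\delta$, with that single additional axiom.
   Context: Fix countably many justification variables, propositional variables, and primitive function symbols of each arity $n\ge0$; a primitive term is $f(x_1,\dots,x_n)$. Terms of $\mathsf{QLP}^-$: $t::= x\mid f(x_1,\dots,x_n)\mid t\cdot t\mid t+t\mid !t$. Formulas: $A::= p\mid\bot\mid\neg A\mid A\wedge A\mid A\vee A\mid A\rightarrow A\mid t:A\mid(\forall x)A\mid(\exists x)A$. Axioms: all propositional tautologies; Q1: $(\forall x)A(x)\rightarrow A(t)$, $t$ free for $x$; Q2: $(\forall x)(A\rightarrow B(x))\rightarrow(A\rightarrow(\forall x)B(x))$, $x$ not free in $A$; Q3: $A(t)\rightarrow(\exists x)A(x)$, $t$ free for $x$; Q4: $(\forall x)(A(x)\rightarrow B)\rightarrow((\exists x)A(x)\rightarrow B)$, $x$ not free in $B$; jK: $s:(A\rightarrow B)\rightarrow(t:A\rightarrow(s\cdot t):B)$; jT: $t:A\rightarrow A$; j4: $t:A\rightarrow !t:t:A$; Sum: $s:A\rightarrow(s+t):A$, $s:A\rightarrow(t+s):A$. Rules: Modus Ponens; Gen: from $A$ infer $(\forall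 x)A$; Axiom Necessitation: from an axiom instance $A$ infer $f(x_1,\dots,x_n):A$. The subscript $\emptyset$ means Axiom Necessitation is dropped. All schemes and rules apply to formulas of the extended language. -}

module Defs where

open import Data.Nat using (ℕ)
open import Data.Bool using (Bool; true; false; _∧_; _∨_; not; if_then_else_)
open import Data.Vec using (Vec; map)
open import Data.Vec.Membership.Propositional using () renaming (_∈_ to _∈ᵥ_)
open import Data.Nat using (_≡ᵇ_)
open import Relation.Binary.PropositionalEquality using (_≡_; _≢_)
open import Relation.Nullary using (¬_)

-- Justification variables, propositional variables and primitive
-- function symbols are named by natural numbers; a primitive function
-- symbol is determined by its arity n and an index i.

data Tm : Set where
  var  : ℕ → Tm
  prim : (n i : ℕ) → Vec ℕ n → Tm
  _·_  : Tm → Tm → Tm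
  _⊕_  : Tm → Tm → Tm
  !_   : Tm → Tm

data Fm : Set where
  atom : ℕ → Fm
  δ    : Fm
  ⊥'   : Fm
  ¬'_  : Fm → Fm
  _∧'_ : Fm → Fm → Fm
  _∨'_ : Fm → Fm → Fm
  _⇒_  : Fm → Fm → Fm
  _∶_  : Tm → Fm → Fm
  ∀'   : ℕ → Fm → Fm
  ∃'   : ℕ → Fm → Fm

infixr 4 _⇒_
infixr 6 _∧'_ _∨'_
infix 8 _∶_
infix 9 ¬'_

_⇔'_ : Fm → Fm → Fm
A ⇔' B = (A ⇒ B) ∧' (B ⇒ A)

_⊻'_ : Fm → Fm → Fm
A ⊻' B = (A ∨' B) ∧' ¬' (A ∧' B)

data OccT (x : ℕ) : Tm → Set where
  var  : OccT x (var x)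
  prim : ∀ {n i ys} → x ∈ᵥ ys → OccT x (prim n i ys)
  ·ˡ   : ∀ {s t} → OccT x s → OccT x (s · t)
  ·ʳ   : ∀ {s t} → OccT x t → OccT x (s · t)
  ⊕ˡ   : ∀ {s t} → OccT x s → OccT x (s ⊕ t)
  ⊕ʳ   : ∀ {s t} → OccT x t → OccT x (s ⊕ t)
  !occ : ∀ {t} → OccT x t → OccT x (! t)

data FreeIn (x : ℕ) : Fm → Set where
  fv-¬ : ∀ {A} → FreeIn x A → FreeIn x (¬' A)
  fv-∧ˡ : ∀ {A B} → FreeIn x A → FreeIn x (A ∧' B)
  fv-∧ʳ : ∀ {A B} → FreeIn x B → FreeIn x (A ∧' B)
  fv-∨ˡ : ∀ {A B} → FreeIn x A → FreeIn x (A ∨' B)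
  fv-∨ʳ : ∀ {A B} → FreeIn x B → FreeIn x (A ∨' B)
  fv-⇒ˡ : ∀ {A B} → FreeIn x A → FreeIn x (A ⇒ B)
  fv-⇒ʳ : ∀ {A B} → FreeIn x B → FreeIn x (A ⇒ B)
  fv-∶ˡ : ∀ {t A} → OccT x t → FreeIn x (t ∶ A)
  fv-∶ʳ : ∀ {t A} → FreeIn x A → FreeIn x (t ∶ A)
  fv-∀ : ∀ {y A} → y ≢ x → FreeIn x A → FreeIn x (∀' y A)
  fv-∃ : ∀ {y A} → y ≢ x → FreeIn x A → FreeIn x (∃' y A)

-- Substitution A(t) of a term t for the free occurrences of x, as a
-- relation  SubF x t A B  ("B is A(t), and t is free for x in A").
-- Inside a primitive term f(y₁,…,yₙ) the variable x may only be
-- replaced when t is itself a variable (otherwise the result would not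
-- be a term); a primitive term not containing x is left unchanged.

rename : ℕ → ℕ → ℕ → ℕ
rename x z y = if y ≡ᵇ x then z else y

data SubT (x : ℕ) (t : Tm) : Tm → Tm → Set where
  var-hit   : SubT x t (var x) t
  var-miss  : ∀ {y} → y ≢ x → SubT x t (var y) (var y)
  prim-miss : ∀ {n i ys} → ¬ (x ∈ᵥ ys) → SubT x t (prim n i ys) (prim n i ys)
  prim-var  : ∀ {n i ys z} → t ≡ var z →
              SubT x t (prim n i ys) (prim n i (map (rename x z) ys))
  ·sub      : ∀ {s s' r r'} → SubT x t s s' → SubT x t r r' → SubT x t (s · r) (s' · r')
  ⊕sub      : ∀ {s s' r r'} → SubT x t s s' → SubT x t r r' → SubT x t (s ⊕ r) (s' ⊕ r')
  !sub      : ∀ {s s'} → SubT x t s s' → SubT x t (! s) (! s')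

data SubF (x : ℕ) (t : Tm) : Fm → Fm → Set where
  sb-atom : ∀ {p} → SubF x t (atom p) (atom p)
  sb-δ : SubF x t δ δ
  sb-⊥ : SubF x t ⊥' ⊥'
  sb-¬ : ∀ {A A'} → SubF x t A A' → SubF x t (¬' A) (¬' A')
  sb-∧ : ∀ {A A' B B'} → SubF x t A A' → SubF x t B B' → SubF x t (A ∧' B) (A' ∧' B')
  sb-∨ : ∀ {A A' B B'} → SubF x t A A' → SubF x t B B' → SubF x t (A ∨' B) (A' ∨' B')
  sb-⇒ : ∀ {A A' B B'} → SubF x t A A' → SubF x t B B' → SubF x t (A ⇒ B) (A' ⇒ B')
  sb-∶ : ∀ {s s' A A'} → SubT x t s s' → SubF x t A A' → SubF x t (s ∶ A) (s' ∶ A')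
  sb-∀-skip : ∀ {y A} → ¬ FreeIn x (∀' y A) → SubF x t (∀' y A) (∀' y A)
  sb-∃-skip : ∀ {y A} → ¬ FreeIn x (∃' y A) → SubF x t (∃' y A) (∃' y A)
  sb-∀-go : ∀ {y A A'} → y ≢ x → ¬ OccT y t → SubF x t A A' → SubF x t (∀' y A) (∀' y A')
  sb-∃-go : ∀ {y A A'} → y ≢ x → ¬ OccT y t → SubF x t A A' → SubF x t (∃' y A) (∃' y A')

⟦_⟧ : (Fm → Bool) → Fm → Bool
⟦ v ⟧ (atom p)  = v (atom p)
⟦ v ⟧ δ         = v δ
⟦ v ⟧ ⊥'        = false
⟦ v ⟧ (¬' A)    = not (⟦ v ⟧ A)
⟦ v ⟧ (A ∧' B)  = ⟦ v ⟧ A ∧ ⟦ v ⟧ B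
⟦ v ⟧ (A ∨' B)  = ⟦ v ⟧ A ∨ ⟦ v ⟧ B
⟦ v ⟧ (A ⇒ B)   = not (⟦ v ⟧ A) ∨ ⟦ v ⟧ B
⟦ v ⟧ (t ∶ A)   = v (t ∶ A)
⟦ v ⟧ (∀' x A)  = v (∀' x A)
⟦ v ⟧ (∃' x A)  = v (∃' x A)

Tautology : Fm → Set
Tautology A = ∀ (v : Fm → Bool) → ⟦ v ⟧ A ≡ true

data Axiom : Fm → Set where
  taut : ∀ {A} → Tautology A → Axiom A
  Q1   : ∀ {x t A B} → SubF x t A B → Axiom (∀' x A ⇒ B)
  Q2   : ∀ {x A B} → ¬ FreeIn x A → Axiom (∀' x (A ⇒ B) ⇒ (A ⇒ ∀' x B))
  Q3   : ∀ {x t A B} → SubF x t A B → Axiom (B ⇒ ∃' x A)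
  Q4   : ∀ {x A B} → ¬ FreeIn x B → Axiom (∀' x (A ⇒ B) ⇒ (∃' x A ⇒ B))
  jK   : ∀ {s t A B} → Axiom (s ∶ (A ⇒ B) ⇒ (t ∶ A ⇒ (s · t) ∶ B))
  jT   : ∀ {t A} → Axiom (t ∶ A ⇒ A)
  j4   : ∀ {t A} → Axiom (t ∶ A ⇒ (! t) ∶ (t ∶ A))
  sumˡ : ∀ {s t A} → Axiom (s ∶ A ⇒ (s ⊕ t) ∶ A)
  sumʳ : ∀ {s t A} → Axiom (s ∶ A ⇒ (t ⊕ s) ∶ A)

δAxiom : (E₁ E₂ x : ℕ) → Fm
δAxiom E₁ E₂ x =
  δ ⇔' ((atom E₁ ∧' ¬' ∃' x (var x ∶ (δ ⇒ atom E₁)))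
        ⊻' (atom E₂ ∧' ¬' ∃' x (var x ∶ ((δ ∧' ¬' atom E₁) ⇒ atom E₂))))

-- Provability in QLP⁻(δAxiom)_∅ : Modus Ponens and Gen only
-- (no Axiom Necessitation), plus the single extra axiom.
data _⊢_ (Ax : Fm) : Fm → Set where
  ax    : ∀ {A} → Axiom A → Ax ⊢ A
  extra : Ax ⊢ Ax
  mp    : ∀ {A B} → Ax ⊢ (A ⇒ B) → Ax ⊢ A → Ax ⊢ B
  gen   : ∀ {A} (x : ℕ) → Ax ⊢ A → Ax ⊢ ∀' x A

infix 2 _⊢_

module Submission where

-- Proof idea: a "justification-forgetting" Boolean semantics.
-- Interpret every justification assertion t:A as false, make the
-- quantifiers transparent ((∀x)A and (∃x)A mean A), read propositional
-- variables through a valuation ρ and δ as a fixed truth value d.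
-- Under this reading every axiom of QLP⁻ is true (jT, j4, jK and Sum
-- have a false antecedent, Q1–Q4 become instances of A → A because
-- substitution only changes terms), Modus Ponens preserves truth and
-- Gen is trivial; Axiom Necessitation, which would force some f:A to be
-- true, is exactly the rule that is absent.  So every theorem of
-- QLP⁻(Ax)_∅ is true whenever Ax is.
-- Taking ρ(E₁) = true, ρ(E₂) = false and δ = true, both justification
-- existentials in the δ-axiom are false, its right-hand side becomes
-- E₁ ⊻ E₂ = true, and the axiom holds; since ¬δ is false, it is not
-- derivable.

open import Defs
open import Data.Nat using (ℕ; _≟_)
open import Data.Bool using (Bool; true; false; _∧_; _∨_; not)
open import Data.Bool.Properties using (∨-inverseˡ)
open import Relation.Binary.PropositionalEquality using (_≡_; _≢_; refl; sym; trans; cong; cong₂)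
open import Relation.Nullary using (¬_; does)
open import Relation.Nullary.Decidable using (dec-true; dec-false)

forget : (ρ : ℕ → Bool) (d : Bool) → Fm → Bool
forget ρ d (atom p)  = ρ p
forget ρ d δ         = d
forget ρ d ⊥'        = false
forget ρ d (¬' A)    = not (forget ρ d A)
forget ρ d (A ∧' B)  = forget ρ d A ∧ forget ρ d B
forget ρ d (A ∨' B)  = forget ρ d A ∨ forget ρ d B
forget ρ d (A ⇒ B)   = not (forget ρ d A) ∨ forget ρ d B
forget ρ d (t ∶ A)   = false
forget ρ d (∀' x A)  = forget ρ d A
forget ρ d (∃' x A)  = forget ρ d A

forget-is-valuation : ∀ ρ d A → ⟦ forget ρ d ⟧ A ≡ forget ρ d A
forget-is-valuation ρ d (atom p) = refl
forget-is-valuation ρ d δ        = refl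
forget-is-valuation ρ d ⊥'       = refl
forget-is-valuation ρ d (¬' A)   = cong not (forget-is-valuation ρ d A)
forget-is-valuation ρ d (A ∧' B) = cong₂ _∧_ (forget-is-valuation ρ d A) (forget-is-valuation ρ d B)
forget-is-valuation ρ d (A ∨' B) = cong₂ _∨_ (forget-is-valuation ρ d A) (forget-is-valuation ρ d B)
forget-is-valuation ρ d (A ⇒ B)  = cong₂ (λ a b → not a ∨ b) (forget-is-valuation ρ d A) (forget-is-valuation ρ d B)
forget-is-valuation ρ d (t ∶ A)  = refl
forget-is-valuation ρ d (∀' x A) = refl
forget-is-valuation ρ d (∃' x A) = refl

-- Substitution only changes terms, which the interpretation ignores,
-- so A and A(t) have the same value (this validates Q1 and Q3).
forget-subst : ∀ ρ d {x t A B} → SubF x t A B → forget ρ d A ≡ forget ρ d B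
forget-subst ρ d sb-atom         = refl
forget-subst ρ d sb-δ            = refl
forget-subst ρ d sb-⊥            = refl
forget-subst ρ d (sb-¬ s)        = cong not (forget-subst ρ d s)
forget-subst ρ d (sb-∧ s r)      = cong₂ _∧_ (forget-subst ρ d s) (forget-subst ρ d r)
forget-subst ρ d (sb-∨ s r)      = cong₂ _∨_ (forget-subst ρ d s) (forget-subst ρ d r)
forget-subst ρ d (sb-⇒ s r)      = cong₂ (λ a b → not a ∨ b) (forget-subst ρ d s) (forget-subst ρ d r)
forget-subst ρ d (sb-∶ _ _)      = refl
forget-subst ρ d (sb-∀-skip _)   = refl
forget-subst ρ d (sb-∃-skip _)   = refl
forget-subst ρ d (sb-∀-go _ _ s) = forget-subst ρ d s
forget-subst ρ d (sb-∃-go _ _ s) = forget-subst ρ d s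

⇒-true-if-equal : ∀ b c → b ≡ c → not b ∨ c ≡ true
⇒-true-if-equal b .b refl = ∨-inverseˡ b

axiom-true : ∀ ρ d {A} → Axiom A → forget ρ d A ≡ true
axiom-true ρ d {A} (taut τ)       = trans (sym (forget-is-valuation ρ d A)) (τ (forget ρ d))
axiom-true ρ d (Q1 s)             = ⇒-true-if-equal _ _ (forget-subst ρ d s)
axiom-true ρ d (Q2 {A = A} {B} _) = ∨-inverseˡ (not (forget ρ d A) ∨ forget ρ d B)
axiom-true ρ d (Q3 s)             = ⇒-true-if-equal _ _ (sym (forget-subst ρ d s))
axiom-true ρ d (Q4 {A = A} {B} _) = ∨-inverseˡ (not (forget ρ d A) ∨ forget ρ d B)
axiom-true ρ d jK                 = refl
axiom-true ρ d jT                 = refl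
axiom-true ρ d j4                 = refl
axiom-true ρ d sumˡ               = refl
axiom-true ρ d sumʳ               = refl

⇒-elim : ∀ {a b} → not a ∨ b ≡ true → a ≡ true → b ≡ true
⇒-elim {true} a⇒b refl = a⇒b

soundness : ∀ ρ d {Ax} → forget ρ d Ax ≡ true → ∀ {A} → Ax ⊢ A → forget ρ d A ≡ true
soundness ρ d Ax-true (ax a)    = axiom-true ρ d a
soundness ρ d Ax-true extra     = Ax-true
soundness ρ d Ax-true (mp p q)  = ⇒-elim (soundness ρ d Ax-true p) (soundness ρ d Ax-true q)
soundness ρ d Ax-true (gen x p) = soundness ρ d Ax-true p

-- With δ true, E₁ true and E₂ false the δ-axiom holds: both justification
-- existentials are false, so its right-hand side reduces to E₁ ⊻ E₂.
δAxiom-true : ∀ ρ E₁ E₂ x → ρ E₁ ≡ true → ρ E₂ ≡ false → forget ρ true (δAxiom E₁ E₂ x) ≡ true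
δAxiom-true ρ E₁ E₂ x E₁-true E₂-false rewrite E₁-true | E₂-false = refl

theorem30 : (E₁ E₂ x : ℕ) → E₁ ≢ E₂ → ¬ (δAxiom E₁ E₂ x ⊢ ¬' δ)
theorem30 E₁ E₂ x E₁≢E₂ ⊢¬δ = ¬δ-false (soundness ρ true axiom-holds ⊢¬δ)
  where
  ρ : ℕ → Bool
  ρ n = does (n ≟ E₁)

  axiom-holds : forget ρ true (δAxiom E₁ E₂ x) ≡ true
  axiom-holds = δAxiom-true ρ E₁ E₂ x (dec-true (E₁ ≟ E₁) refl)
                  (dec-false (E₂ ≟ E₁) (λ E₂≡E₁ → E₁≢E₂ (sym E₂≡E₁)))

  ¬δ-false : forget ρ true (¬' δ) ≢ true
  ¬δ-false ()
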